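{- Let $I$ be a small category and let $(\mathcal{L}(i))_{i \in I}$ be a family of complete Heyting algebras. Then $\mathbf{FuzzyPresheaf}(I,\mathcal{L})$ is locally cartesian closed.
   Context: An $\mathcal{L}$-fuzzy presheaf is a pair $(A,\alpha)$ where $A: I^{op}\to \mathbf{Set}$ is a functor and $\alpha=(\alpha_i : A(i)\to \mathcal{L}(i))_{i\in I}$ is a family of functions. A morphism $f:(A,\alpha)\to(B,\beta)$ is a natural transformation $f:A\to B$ with $\alpha_i \leq \beta_i f_i$ pointwise for all $i$. A category is locally cartesian closed if each of its slice categories is cartesian closed. -}

module Defs where

open import Level using (Level; suc; _⊔_)
open import Relation.Binary using (Setoid; Rel; IsEquivalence; Poset)
open import Relation.Binary.Lattice.Bundles using (HeytingAlgebra)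

record Category (o m e : Level) : Set (suc (o ⊔ m ⊔ e)) where
  infix  4 _≈_
  infixr 9 _∘_
  field
    Obj       : Set o
    _⇒_       : Obj → Obj → Set m
    _≈_       : ∀ {A B} → Rel (A ⇒ B) e
    id        : ∀ {A} → A ⇒ A
    _∘_       : ∀ {A B C} → B ⇒ C → A ⇒ B → A ⇒ C
    equiv     : ∀ {A B} → IsEquivalence (_≈_ {A} {B})
    assoc     : ∀ {A B C D} {f : A ⇒ B} {g : B ⇒ C} {h : C ⇒ D} →
                (h ∘ g) ∘ f ≈ h ∘ (g ∘ f)
    identityˡ : ∀ {A B} {f : A ⇒ B} → id ∘ f ≈ f
    identityʳ : ∀ {A B} {f : A ⇒ B} → f ∘ id ≈ f
    ∘-resp-≈  : ∀ {A B C} {f h : B ⇒ C} {g i : A ⇒ B} →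
                f ≈ h → g ≈ i → f ∘ g ≈ h ∘ i

module _ {o m e} (C : Category o m e) where
  open Category C
  private
    module E {A B} = IsEquivalence (equiv {A} {B})

  record SliceObj (X : Obj) : Set (o ⊔ m) where
    constructor sliceObj
    field
      {dom} : Obj
      arr   : dom ⇒ X

  record SliceHom (X : Obj) (A B : SliceObj X) : Set (m ⊔ e) where
    constructor sliceHom
    field
      h       : SliceObj.dom A ⇒ SliceObj.dom B
      commute : SliceObj.arr B ∘ h ≈ SliceObj.arr A

  Slice : Obj → Category (o ⊔ m) (m ⊔ e) e
  Slice X = record
    { Obj = SliceObj X
    ; _⇒_ = SliceHom X
    ; _≈_ = λ f g → SliceHom.h f ≈ SliceHom.h g
    ; id = sliceHom id identityʳ
    ; _∘_ = λ { {A} {B} {C'} (sliceHom g cg) (sliceHom f cf) →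
        sliceHom (g ∘ f)
          (E.trans (E.sym assoc) (E.trans (∘-resp-≈ cg E.refl) cf)) }
    ; equiv = record { refl = E.refl ; sym = E.sym ; trans = E.trans }
    ; assoc = assoc
    ; identityˡ = identityˡ
    ; identityʳ = identityʳ
    ; ∘-resp-≈ = ∘-resp-≈
    }

module _ {o m e} (C : Category o m e) where
  open Category C

  record Terminal : Set (o ⊔ m ⊔ e) where
    field
      ⊤        : Obj
      !        : ∀ {A} → A ⇒ ⊤
      !-unique : ∀ {A} (f : A ⇒ ⊤) → f ≈ !

  record Product (A B : Obj) : Set (o ⊔ m ⊔ e) where
    field
      A×B      : Obj
      π₁       : A×B ⇒ A
      π₂       : A×B ⇒ B
      ⟨_,_⟩    : ∀ {X} → X ⇒ A → X ⇒ B → X ⇒ A×B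
      project₁ : ∀ {X} {f : X ⇒ A} {g : X ⇒ B} → π₁ ∘ ⟨ f , g ⟩ ≈ f
      project₂ : ∀ {X} {f : X ⇒ A} {g : X ⇒ B} → π₂ ∘ ⟨ f , g ⟩ ≈ g
      unique   : ∀ {X} {h : X ⇒ A×B} {f : X ⇒ A} {g : X ⇒ B} →
                 π₁ ∘ h ≈ f → π₂ ∘ h ≈ g → ⟨ f , g ⟩ ≈ h

  module _ (prod : ∀ A B → Product A B) where
    _×id[_] : ∀ {X Y} → X ⇒ Y → (A : Obj) →
              Product.A×B (prod X A) ⇒ Product.A×B (prod Y A)
    _×id[_] {X} {Y} g A =
      Product.⟨_,_⟩ (prod Y A) (g ∘ Product.π₁ (prod X A)) (Product.π₂ (prod X A))

    record Exponential (A B : Obj) : Set (o ⊔ m ⊔ e) where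
      field
        B^A    : Obj
        eval   : Product.A×B (prod B^A A) ⇒ B
        curry  : ∀ {X} → Product.A×B (prod X A) ⇒ B → X ⇒ B^A
        β      : ∀ {X} {f : Product.A×B (prod X A) ⇒ B} →
                 eval ∘ (curry f ×id[ A ]) ≈ f
        unique : ∀ {X} {f : Product.A×B (prod X A) ⇒ B} {g : X ⇒ B^A} →
                 eval ∘ (g ×id[ A ]) ≈ f → g ≈ curry f

  record CartesianClosed : Set (o ⊔ m ⊔ e) where
    field
      terminal     : Terminal
      products     : ∀ A B → Product A B
      exponentials : ∀ A B → Exponential products A B

LocallyCartesianClosed : ∀ {o m e} → Category o m e → Set (o ⊔ m ⊔ e)
LocallyCartesianClosed C = ∀ X → CartesianClosed (Slice C X)

record CompleteHeytingAlgebra (c ℓ₁ ℓ₂ ι : Level) : Set (suc (c ⊔ ℓ₁ ⊔ ℓ₂ ⊔ ι)) where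
  field
    heytingAlgebra : HeytingAlgebra c ℓ₁ ℓ₂
  open HeytingAlgebra heytingAlgebra public
  field
    ⋁       : {J : Set ι} → (J → Carrier) → Carrier
    ⋁-upper : ∀ {J : Set ι} (f : J → Carrier) (j : J) → f j ≤ ⋁ f
    ⋁-least : ∀ {J : Set ι} (f : J → Carrier) {y} → (∀ j → f j ≤ y) → ⋁ f ≤ y
    ⋀       : {J : Set ι} → (J → Carrier) → Carrier
    ⋀-lower : ∀ {J : Set ι} (f : J → Carrier) (j : J) → ⋀ f ≤ f j
    ⋀-great : ∀ {J : Set ι} (f : J → Carrier) {y} → (∀ j → y ≤ f j) → y ≤ ⋀ f

module _ {ℓ} (I : Category ℓ ℓ ℓ) where
  open Category I

  record Presheaf : Set (suc ℓ) where
    field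
      F₀           : Obj → Setoid ℓ ℓ
      F₁           : ∀ {i j} → j ⇒ i → Setoid.Carrier (F₀ i) → Setoid.Carrier (F₀ j)
      F₁-cong      : ∀ {i j} (f : j ⇒ i) {x y} →
                     Setoid._≈_ (F₀ i) x y → Setoid._≈_ (F₀ j) (F₁ f x) (F₁ f y)
      F-resp-≈     : ∀ {i j} {f g : j ⇒ i} → f ≈ g →
                     ∀ x → Setoid._≈_ (F₀ j) (F₁ f x) (F₁ g x)
      identity     : ∀ {i} x → Setoid._≈_ (F₀ i) (F₁ (id {i}) x) x
      homomorphism : ∀ {i j k} (f : j ⇒ i) (g : k ⇒ j) x →
                     Setoid._≈_ (F₀ k) (F₁ (f ∘ g) x) (F₁ g (F₁ f x))

module _ {ℓ c ℓ₁ ℓ₂} (I : Category ℓ ℓ ℓ)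
         (L : Category.Obj I → CompleteHeytingAlgebra c ℓ₁ ℓ₂ ℓ) where
  open Category I using (Obj; _⇒_)
  module L i = CompleteHeytingAlgebra (L i)

  record FuzzyPresheaf : Set (suc ℓ ⊔ c ⊔ ℓ₁) where
    field
      A      : Presheaf I
      α      : ∀ i → Setoid.Carrier (Presheaf.F₀ A i) → L.Carrier i
      α-cong : ∀ i {x y} → Setoid._≈_ (Presheaf.F₀ A i) x y → L._≈_ i (α i x) (α i y)

  private
    Car : FuzzyPresheaf → Obj → Set ℓ
    Car X i = Setoid.Carrier (Presheaf.F₀ (FuzzyPresheaf.A X) i)
    Eq : (X : FuzzyPresheaf) → (i : Obj) → Car X i → Car X i → Set ℓ
    Eq X i = Setoid._≈_ (Presheaf.F₀ (FuzzyPresheaf.A X) i)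
    Act : (X : FuzzyPresheaf) → ∀ {i j} → j ⇒ i → Car X i → Car X j
    Act X = Presheaf.F₁ (FuzzyPresheaf.A X)

  record FuzzyHom (X Y : FuzzyPresheaf) : Set (ℓ ⊔ ℓ₂) where
    constructor fuzzyHom
    field
      η       : ∀ i → Car X i → Car Y i
      η-cong  : ∀ i {x y} → Eq X i x y → Eq Y i (η i x) (η i y)
      natural : ∀ {i j} (f : j ⇒ i) x → Eq Y j (η j (Act X f x)) (Act Y f (η i x))
      fuzzy   : ∀ i x → L._≤_ i (FuzzyPresheaf.α X i x) (FuzzyPresheaf.α Y i (η i x))

  private
    module S X i = Setoid (Presheaf.F₀ (FuzzyPresheaf.A X) i)

    idH : ∀ {X} → FuzzyHom X X
    idH {X} = fuzzyHom (λ i x → x) (λ i p → p) (λ f x → S.refl X _)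
                       (λ i x → Poset.refl (L.poset i))

    compH : ∀ {X Y Z} → FuzzyHom Y Z → FuzzyHom X Y → FuzzyHom X Z
    compH {X} {Y} {Z} (fuzzyHom g gc gn gf) (fuzzyHom f fc fn ff) =
      fuzzyHom (λ i x → g i (f i x)) (λ i p → gc i (fc i p))
        (λ {i} {j} h x → S.trans Z j (gc j (fn h x)) (gn h (f i x)))
        (λ i x → Poset.trans (L.poset i) (ff i x) (gf i (f i x)))

  FuzzyPresheafCat : Category (suc ℓ ⊔ c ⊔ ℓ₁) (ℓ ⊔ ℓ₂) ℓ
  FuzzyPresheafCat = record
    { Obj = FuzzyPresheaf
    ; _⇒_ = FuzzyHom
    ; _≈_ = λ {X} {Y} f g → ∀ i x → Eq Y i (FuzzyHom.η f i x) (FuzzyHom.η g i x)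
    ; id = idH
    ; _∘_ = compH
    ; equiv = λ {X} {Y} → record
        { refl = λ i x → S.refl Y i
        ; sym = λ p i x → S.sym Y i (p i x)
        ; trans = λ p q i x → S.trans Y i (p i x) (q i x) }
    ; assoc = λ {D = D} i x → S.refl D i
    ; identityˡ = λ {B = B} i x → S.refl B i
    ; identityʳ = λ {B = B} i x → S.refl B i
    ; ∘-resp-≈ = λ {C = C} {h = h} {g = g} p q i x →
        S.trans C i (p i (FuzzyHom.η g i x)) (FuzzyHom.η-cong h i (q i x))
    }

-- An object of the slice over (X, ξ) is a fuzzy presheaf (A, α) with a map p : A → X such that
-- α ≤ ξ ∘ p, so the cartesian closed structure is that of presheaves over X, with membership
-- degrees added. The product is the fibre product with the meet of the two degrees. An element of
-- B^A at stage i is a point x of X with a map φ : y(i) ×_X A → B over X, and its degree is the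
-- largest one below ξ(x) that makes evaluation fuzzy, ξ(x) ∧ ⋀ { α(a) ⇨ β(φ a) ∣ a over x }; this
-- meet exists because L(i) is complete, and currying is fuzzy because ⇨ is right adjoint to ∧.
module Submission where

open import Level using (suc; _⊔_)
open import Data.Product using (Σ; _×_; _,_; proj₁; proj₂)
open import Relation.Binary using (Setoid; IsEquivalence)
import Relation.Binary.Lattice.Properties.HeytingAlgebra as HeytingProperties
import Relation.Binary.Lattice.Properties.MeetSemilattice as MeetProperties
open import Defs

module FuzzyPresheafSlices {ℓ c ℓ₁ ℓ₂} (I : Category ℓ ℓ ℓ)
         (L : Category.Obj I → CompleteHeytingAlgebra c ℓ₁ ℓ₂ ℓ) where

  open Category I using (Obj; _⇒_; id; _∘_; assoc; identityˡ; identityʳ; ∘-resp-≈)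
    renaming (_≈_ to _≈ᴵ_)
  private
    module ≈ᴵ {i j} = IsEquivalence (Category.equiv I {i} {j})

  module ℒ {i : Obj} where
    open CompleteHeytingAlgebra (L i) public
    open MeetProperties meetSemilattice public using (∧-monotonic; ∧-cong)
    open HeytingProperties heytingAlgebra public using (⇨ʳ-covariant)

  𝒞 : Category (suc ℓ ⊔ c ⊔ ℓ₁) (ℓ ⊔ ℓ₂) ℓ
  𝒞 = FuzzyPresheafCat I L

  module Fuzzy (X : FuzzyPresheaf I L) where
    open FuzzyPresheaf X public using (α; α-cong)
    open Presheaf (FuzzyPresheaf.A X) public

    El : Obj → Set ℓ
    El i = Setoid.Carrier (F₀ i)

    infix 4 _≈_
    _≈_ : ∀ {i} → El i → El i → Set ℓ
    _≈_ {i} = Setoid._≈_ (F₀ i)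

    module _ {i : Obj} where
      open Setoid (F₀ i) public using (refl; sym; trans)

  open FuzzyHom
  open SliceObj
  open SliceHom

  module _ (X : FuzzyPresheaf I L) where
    private
      module X = Fuzzy X
      module 𝒞/X = Category (Slice 𝒞 X)

    sliceTerminal : Terminal (Slice 𝒞 X)
    sliceTerminal = record
      { ⊤        = sliceObj (Category.id 𝒞)
      ; !        = λ {A} → sliceHom (arr A) (λ i x → X.refl)
      ; !-unique = commute
      }

    module FibreProduct (A B : SliceObj 𝒞 X) where
      private
        module A = Fuzzy (dom A)
        module B = Fuzzy (dom B)

        p : FuzzyHom I L (dom A) X
        p = arr A

        q : FuzzyHom I L (dom B) X
        q = arr B

      Pair : Obj → Set ℓ
      Pair i = Σ (A.El i) λ a → Σ (B.El i) λ b → η p i a X.≈ η q i b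

      pairSetoid : Obj → Setoid ℓ ℓ
      pairSetoid i = record
        { Carrier       = Pair i
        ; _≈_           = λ (a , b , _) (a' , b' , _) → a A.≈ a' × b B.≈ b'
        ; isEquivalence = record
          { refl  = A.refl , B.refl
          ; sym   = λ (a≈ , b≈) → A.sym a≈ , B.sym b≈
          ; trans = λ (a≈ , b≈) (a≈' , b≈') → A.trans a≈ a≈' , B.trans b≈ b≈'
          }
        }

      restrictPair : ∀ {i j} → j ⇒ i → Pair i → Pair j
      restrictPair f (a , b , e) =
        A.F₁ f a , B.F₁ f b ,
        X.trans (natural p f a) (X.trans (X.F₁-cong f e) (X.sym (natural q f b)))

      apex : FuzzyPresheaf I L
      apex = record
        { A      = record
          { F₀           = pairSetoid
          ; F₁           = restrictPair
          ; F₁-cong      = λ f (a≈ , b≈) → A.F₁-cong f a≈ , B.F₁-cong f b≈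
          ; F-resp-≈     = λ f≈g (a , b , _) → A.F-resp-≈ f≈g a , B.F-resp-≈ f≈g b
          ; identity     = λ (a , b , _) → A.identity a , B.identity b
          ; homomorphism = λ f g (a , b , _) → A.homomorphism f g a , B.homomorphism f g b
          }
        ; α      = λ i (a , b , _) → A.α i a ℒ.∧ B.α i b
        ; α-cong = λ i (a≈ , b≈) → ℒ.∧-cong (A.α-cong i a≈) (B.α-cong i b≈)
        }

      A×ₓB : SliceObj 𝒞 X
      A×ₓB = sliceObj {dom = apex}
        (fuzzyHom (λ i (a , _ , _) → η p i a) (λ i (a≈ , _) → η-cong p i a≈)
                  (λ f (a , _ , _) → natural p f a)
                  (λ i (a , _ , _) → ℒ.trans (ℒ.x∧y≤x _ _) (fuzzy p i a)))

      π₁ : SliceHom 𝒞 X A×ₓB A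
      π₁ = sliceHom
        (fuzzyHom (λ i (a , _ , _) → a) (λ i (a≈ , _) → a≈) (λ f _ → A.refl)
                  (λ i _ → ℒ.x∧y≤x _ _))
        (λ i _ → X.refl)

      π₂ : SliceHom 𝒞 X A×ₓB B
      π₂ = sliceHom
        (fuzzyHom (λ i (_ , b , _) → b) (λ i (_ , b≈) → b≈) (λ f _ → B.refl)
                  (λ i _ → ℒ.x∧y≤y _ _))
        (λ i (_ , _ , e) → X.sym e)

      ⟨_,_⟩ : ∀ {Z} → SliceHom 𝒞 X Z A → SliceHom 𝒞 X Z B → SliceHom 𝒞 X Z A×ₓB
      ⟨ f , g ⟩ = sliceHom
        (fuzzyHom (λ i z → η (h f) i z , η (h g) i z ,
                             X.trans (commute f i z) (X.sym (commute g i z)))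
                  (λ i z≈ → η-cong (h f) i z≈ , η-cong (h g) i z≈)
                  (λ k z → natural (h f) k z , natural (h g) k z)
                  (λ i z → ℒ.∧-greatest (fuzzy (h f) i z) (fuzzy (h g) i z)))
        (commute f)

      product : Product (Slice 𝒞 X) A B
      product = record
        { A×B      = A×ₓB
        ; π₁       = π₁
        ; π₂       = π₂
        ; ⟨_,_⟩    = ⟨_,_⟩
        ; project₁ = λ i z → A.refl
        ; project₂ = λ i z → B.refl
        ; unique   = λ π₁∘h≈f π₂∘h≈g i z → A.sym (π₁∘h≈f i z) , B.sym (π₂∘h≈g i z)
        }

    sliceProducts : ∀ A B → Product (Slice 𝒞 X) A B
    sliceProducts = FibreProduct.product

    module SliceExponential (A B : SliceObj 𝒞 X) where
      private
        module A = Fuzzy (dom A)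
        module B = Fuzzy (dom B)

        p : FuzzyHom I L (dom A) X
        p = arr A

        q : FuzzyHom I L (dom B) X
        q = arr B

      infix 4 _over_
      _over_ : ∀ {j} → A.El j → X.El j → Set ℓ
      _over_ {j} a x = η p j a X.≈ x

      over-resp : ∀ {i j} {x : X.El i} {f f' : j ⇒ i} {a : A.El j} →
                  f ≈ᴵ f' → a over X.F₁ f x → a over X.F₁ f' x
      over-resp {x = x} f≈f' e = X.trans e (X.F-resp-≈ f≈f' x)

      -- A natural map y(i) ×_X A → B over X, where y(i) → X is the element x; an element
      -- (f , a) of y(i) ×_X A at stage j is an f : j ⇒ i with a over X.F₁ f x.
      record FibreMap (i : Obj) (x : X.El i) : Set ℓ where
        field
          app         : ∀ {j} (f : j ⇒ i) (a : A.El j) → a over X.F₁ f x → B.El j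
          app-cong    : ∀ {j} {f f' : j ⇒ i} {a a' : A.El j}
                        (e : a over X.F₁ f x) (e' : a' over X.F₁ f' x) →
                        f ≈ᴵ f' → a A.≈ a' → app f a e B.≈ app f' a' e'
          app-over    : ∀ {j} (f : j ⇒ i) a e → η q j (app f a e) X.≈ η p j a
          app-natural : ∀ {j k} (f : j ⇒ i) (g : k ⇒ j) a e e' →
                        app (f ∘ g) (A.F₁ g a) e' B.≈ B.F₁ g (app f a e)
      open FibreMap

      ExpElement : Obj → Set ℓ
      ExpElement i = Σ (X.El i) (FibreMap i)

      infix 4 _≈ᴱ_
      _≈ᴱ_ : ∀ {i} → ExpElement i → ExpElement i → Set ℓ
      _≈ᴱ_ {i} (x , φ) (x' , ψ) =
        x X.≈ x' × (∀ {j} (f : j ⇒ i) a e e' → app φ f a e B.≈ app ψ f a e')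

      ≈ᴱ-refl : ∀ {i} {u : ExpElement i} → u ≈ᴱ u
      ≈ᴱ-refl {u = _ , φ} = X.refl , λ f a e e' → app-cong φ e e' ≈ᴵ.refl A.refl

      ≈ᴱ-sym : ∀ {i} {u v : ExpElement i} → u ≈ᴱ v → v ≈ᴱ u
      ≈ᴱ-sym (x≈ , φ≈) = X.sym x≈ , λ f a e e' → B.sym (φ≈ f a e' e)

      ≈ᴱ-trans : ∀ {i} {u v w : ExpElement i} → u ≈ᴱ v → v ≈ᴱ w → u ≈ᴱ w
      ≈ᴱ-trans (x≈ , φ≈) (x≈' , ψ≈) =
        X.trans x≈ x≈' ,
        λ f a e e' → B.trans (φ≈ f a e (X.trans e (X.F₁-cong f x≈))) (ψ≈ f a _ e')

      expSetoid : Obj → Setoid ℓ ℓ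
      expSetoid i = record
        { Carrier       = ExpElement i
        ; _≈_           = _≈ᴱ_
        ; isEquivalence = record
          { refl  = λ {u} → ≈ᴱ-refl {u = u}
          ; sym   = λ {u} {v} → ≈ᴱ-sym {u = u} {v}
          ; trans = λ {u} {v} {w} → ≈ᴱ-trans {u = u} {v} {w}
          }
        }

      restrictExp : ∀ {i k} → k ⇒ i → ExpElement i → ExpElement k
      restrictExp g (x , φ) = X.F₁ g x , record
        { app         = λ f a e → app φ (g ∘ f) a (X.trans e (X.sym (X.homomorphism g f x)))
        ; app-cong    = λ e e' f≈f' a≈a' → app-cong φ _ _ (∘-resp-≈ ≈ᴵ.refl f≈f') a≈a'
        ; app-over    = λ f a e → app-over φ _ a _
        ; app-natural = λ f h a e e' → B.trans
            (app-cong φ _ (over-resp (≈ᴵ.sym assoc)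
                             (X.trans e' (X.sym (X.homomorphism g (f ∘ h) x))))
                      (≈ᴵ.sym assoc) A.refl)
            (app-natural φ (g ∘ f) h a _ _)
        }

      expPresheaf : Presheaf I
      expPresheaf = record
        { F₀           = expSetoid
        ; F₁           = restrictExp
        ; F₁-cong      = λ g (x≈ , φ≈) → X.F₁-cong g x≈ , λ f a e e' → φ≈ (g ∘ f) a _ _
        ; F-resp-≈     = λ g≈g' (x , φ) → X.F-resp-≈ g≈g' x ,
                           λ f a e e' → app-cong φ _ _ (∘-resp-≈ g≈g' ≈ᴵ.refl) A.refl
        ; identity     = λ (x , φ) → X.identity x ,
                           λ f a e e' → app-cong φ _ _ identityˡ A.refl
        ; homomorphism = λ g h (x , φ) → X.homomorphism g h x ,
                           λ f a e e' → app-cong φ _ _ assoc A.refl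
        }

      degree : ∀ i → ExpElement i → ℒ.Carrier {i}
      degree i (x , φ) =
        X.α i x ℒ.∧
        ℒ.⋀ {J = Σ (A.El i) λ a → a over X.F₁ id x}
            (λ (a , e) → A.α i a ℒ.⇨ B.α i (app φ id a e))

      degree-mono : ∀ i {u v : ExpElement i} → u ≈ᴱ v → degree i u ℒ.≤ degree i v
      degree-mono i (x≈ , φ≈) =
        ℒ.∧-monotonic (ℒ.reflexive (X.α-cong i x≈))
          (ℒ.⋀-great _ λ (a , e') →
            ℒ.trans (ℒ.⋀-lower _ (a , X.trans e' (X.F₁-cong id (X.sym x≈))))
                    (ℒ.⇨ʳ-covariant (ℒ.reflexive (B.α-cong i (φ≈ id a _ e')))))

      exp : FuzzyPresheaf I L
      exp = record
        { A      = expPresheaf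
        ; α      = degree
        ; α-cong = λ i {u} {v} u≈v →
            ℒ.antisym (degree-mono i {u} {v} u≈v)
                      (degree-mono i {v} {u} (≈ᴱ-sym {u = u} {v} u≈v))
        }

      B^A : SliceObj 𝒞 X
      B^A = sliceObj {dom = exp}
        (fuzzyHom (λ i → proj₁) (λ i → proj₁) (λ f u → X.refl) (λ i u → ℒ.x∧y≤x _ _))

      open FibreProduct B^A A using (Pair; restrictPair; A×ₓB)

      over-id : ∀ {i} {x : X.El i} {a : A.El i} → x X.≈ η p i a → a over X.F₁ id x
      over-id {x = x} e = X.trans (X.sym e) (X.sym (X.identity x))

      evalAt : ∀ {i} → Pair i → B.El i
      evalAt ((x , φ) , a , e) = app φ id a (over-id e)

      evalAt-natural : ∀ {i j} (g : j ⇒ i) (u : Pair i) →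
                       evalAt (restrictPair g u) B.≈ B.F₁ g (evalAt u)
      evalAt-natural g ((x , φ) , a , e) =
        B.trans (app-cong φ _ (over-resp g∘id≈id∘g restricted-over) g∘id≈id∘g A.refl)
                (app-natural φ id g a (over-id e) _)
        where
          g∘id≈id∘g : g ∘ id ≈ᴵ id ∘ g
          g∘id≈id∘g = ≈ᴵ.trans identityʳ (≈ᴵ.sym identityˡ)
          restricted-over : A.F₁ g a over X.F₁ (g ∘ id) x
          restricted-over = X.trans (over-id (X.trans (X.F₁-cong g e) (X.sym (natural p g a))))
                                    (X.sym (X.homomorphism g id x))

      evalAt-cong : ∀ {i} {u v : Pair i} → Setoid._≈_ (FibreProduct.pairSetoid B^A A i) u v →
                    evalAt u B.≈ evalAt v
      evalAt-cong {u = (x , φ) , a , e} {_ , a' , e'} ((x≈ , φ≈) , a≈) =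
        B.trans (app-cong φ (over-id e) (X.trans (over-id e') (X.F₁-cong id (X.sym x≈)))
                          ≈ᴵ.refl a≈)
                (φ≈ id a' _ (over-id e'))

      eval : SliceHom 𝒞 X A×ₓB B
      eval = sliceHom
        (fuzzyHom (λ i → evalAt)
                  (λ i {u} {v} → evalAt-cong {u = u} {v})
                  evalAt-natural
                  (λ i ((x , φ) , a , e) →
                     ℒ.transpose-∧ (ℒ.trans (ℒ.x∧y≤y _ _) (ℒ.⋀-lower _ (a , over-id e)))))
        (λ i ((x , φ) , a , e) → X.trans (app-over φ id a (over-id e)) (X.sym e))

      module Curry {Z : SliceObj 𝒞 X} (g : SliceHom 𝒞 X (FibreProduct.A×ₓB Z A) B) where
        private
          module Z = Fuzzy (dom Z)

          s : FuzzyHom I L (dom Z) X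
          s = arr Z

        restrict-agree : ∀ {i j} (f : j ⇒ i) (z : Z.El i) {a : A.El j} →
                         a over X.F₁ f (η s i z) → η s j (Z.F₁ f z) X.≈ η p j a
        restrict-agree f z e = X.trans (natural s f z) (X.sym e)

        fibreMap : ∀ i (z : Z.El i) → FibreMap i (η s i z)
        fibreMap i z = record
          { app         = λ f a e → η (h g) _ (Z.F₁ f z , a , restrict-agree f z e)
          ; app-cong    = λ e e' f≈f' a≈a' → η-cong (h g) _ (Z.F-resp-≈ f≈f' z , a≈a')
          ; app-over    = λ f a e → X.trans (commute g _ _) (restrict-agree f z e)
          ; app-natural = λ f k a e e' →
              B.trans (η-cong (h g) _ (Z.homomorphism f k z , A.refl))
                      (natural (h g) k (Z.F₁ f z , a , restrict-agree f z e))
          }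

        curried : SliceHom 𝒞 X Z B^A
        curried = sliceHom
          (fuzzyHom (λ i z → η s i z , fibreMap i z)
            (λ i z≈ → η-cong s i z≈ , λ f a e e' → η-cong (h g) _ (Z.F₁-cong f z≈ , A.refl))
            (λ k z → natural s k z ,
               λ f a e e' → η-cong (h g) _ (Z.sym (Z.homomorphism k f z) , A.refl))
            curried-fuzzy)
          (λ i z → X.refl)
          where
            curried-fuzzy : ∀ i z → Z.α i z ℒ.≤ degree i (η s i z , fibreMap i z)
            curried-fuzzy i z =
              ℒ.∧-greatest (fuzzy s i z)
                (ℒ.⋀-great _ λ (a , e) → ℒ.transpose-⇨
                  (ℒ.trans (ℒ.∧-monotonic (ℒ.reflexive (Z.α-cong i (Z.sym (Z.identity z))))
                                          ℒ.refl)
                           (fuzzy (h g) i (Z.F₁ id z , a , restrict-agree id z e))))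

      -- By naturality of k, its fibre maps are determined by their values at f = id.
      curry-unique : ∀ {Z} {g : SliceHom 𝒞 X (FibreProduct.A×ₓB Z A) B} {k : SliceHom 𝒞 X Z B^A} →
                     eval 𝒞/X.∘ (_×id[_] (Slice 𝒞 X) sliceProducts k A) 𝒞/X.≈ g →
                     k 𝒞/X.≈ Curry.curried g
      curry-unique {Z} {g} {k} eval∘k×id≈g i z =
        commute k i z ,
        λ f a e e' → B.trans
          (app-cong φ e _ (≈ᴵ.sym identityʳ) A.refl)
          (B.trans (B.sym (proj₂ (natural (h k) f z) id a _ (X.trans e (X.sym (X.identity _)))))
                   (eval∘k×id≈g _ (Z.F₁ f z , a , Curry.restrict-agree g f z e')))
        where
          module Z = Fuzzy (dom Z)

          φ : FibreMap i (proj₁ (η (h k) i z))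
          φ = proj₂ (η (h k) i z)

      exponential : Exponential (Slice 𝒞 X) sliceProducts A B
      exponential = record
        { B^A    = B^A
        ; eval   = eval
        ; curry  = Curry.curried
        ; β      = λ {Z} {g} i (z , a , _) → η-cong (h g) i (Fuzzy.identity (dom Z) z , A.refl)
        ; unique = λ {Z} {g} {k} → curry-unique {Z} {g} {k}
        }

    sliceCartesianClosed : CartesianClosed (Slice 𝒞 X)
    sliceCartesianClosed = record
      { terminal     = sliceTerminal
      ; products     = sliceProducts
      ; exponentials = SliceExponential.exponential
      }

proposition31 : ∀ {ℓ c ℓ₁ ℓ₂} (I : Category ℓ ℓ ℓ)
                (L : Category.Obj I → CompleteHeytingAlgebra c ℓ₁ ℓ₂ ℓ) →
                LocallyCartesianClosed (FuzzyPresheafCat I L)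
proposition31 I L = FuzzyPresheafSlices.sliceCartesianClosed I L
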